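{- For any integers $n,k,m$ with $k \geq 2$ and $k \leq m \leq n-1$ we have $ex(n;k) \leq \frac{n(n-1)}{m(m-1)}\, ex(m;k)$.
   Context: A digraph has a vertex set and an arc set consisting of ordered pairs of distinct vertices. A walk of length $\ell$ is a sequence $x_0x_1\dots x_\ell$ of vertices with $x_i \rightarrow x_{i+1}$ for all $i$. A digraph is $k$-geodetic if for every ordered pair $(u,v)$ of (not necessarily distinct) vertices there is at most one $u,v$-walk of length at most $k$. For $n,k\ge 2$, $ex(n;k)$ is the largest possible number of arcs of a $k$-geodetic digraph on $n$ vertices. -}

module Defs where

open import Data.Nat using (ℕ; zero; suc; _+_; _*_; _≤_)
open import Data.Bool using (Bool; true; false; T)
open import Data.Fin using (Fin)
open import Data.List using (List; []; _∷_; map; allFin)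
open import Data.Nat.ListAction using (sum)
open import Data.Product using (Σ; _×_)
open import Relation.Binary.PropositionalEquality using (_≡_)

record Digraph (n : ℕ) : Set where
  field
    arc   : Fin n → Fin n → Bool
    loopless : ∀ x → arc x x ≡ false
open Digraph public

_⇒_within_ : ∀ {n} → Fin n → Fin n → Digraph n → Set
x ⇒ y within G = T (arc G x y)

data Walk {n : ℕ} (G : Digraph n) : ℕ → Fin n → Fin n → Set where
  here : ∀ u → Walk G zero u u
  step : ∀ {ℓ u w v} → u ⇒ w within G → Walk G ℓ w v → Walk G (suc ℓ) u v

vertices : ∀ {n} {G : Digraph n} {ℓ u v} → Walk G ℓ u v → List (Fin n)
vertices (here u) = u ∷ []
vertices (step {u = u} _ w) = u ∷ vertices w

-- k-geodetic: for all u v (not necessarily distinct) there is at most one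
-- u,v-walk of length at most k (walks are identified by their vertex sequences).
Geodetic : ∀ {n} → ℕ → Digraph n → Set
Geodetic {n} k G = ∀ (u v : Fin n) {ℓ₁ ℓ₂ : ℕ} → ℓ₁ ≤ k → ℓ₂ ≤ k →
  (w₁ : Walk G ℓ₁ u v) (w₂ : Walk G ℓ₂ u v) → vertices w₁ ≡ vertices w₂

bit : Bool → ℕ
bit true  = 1
bit false = 0

size : ∀ {n} → Digraph n → ℕ
size {n} G = sum (map (λ x → sum (map (λ y → bit (arc G x y)) (allFin n))) (allFin n))

-- IsEx n k e : e = ex(n;k), the largest number of arcs of a k-geodetic digraph on n vertices.
IsEx : ℕ → ℕ → ℕ → Set
IsEx n k e = Σ (Digraph n) (λ G → Geodetic k G × size G ≡ e)
           × (∀ (G : Digraph n) → Geodetic k G → size G ≤ e)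

-- Deleting a vertex keeps a digraph k-geodetic, and each arc of a digraph on
-- N vertices survives in exactly N − 2 of its N vertex-deleted subdigraphs.
-- Summing ex(N − 1; k) over these subdigraphs gives
-- (N − 2) ex(N; k) ≤ N ex(N − 1; k), and the bound telescopes from n down to m.
module Submission where

open import Defs
open import Data.Nat using (ℕ; zero; suc; _+_; _*_; _∸_; _≤_; _<_; _≤′_; ≤′-refl; ≤′-step; z≤n; NonZero; >-nonZero)
open import Data.Nat.Properties
open import Data.Nat.Solver using (module +-*-Solver)
import Data.Nat.ListAction as List
open import Data.Fin using (Fin; punchIn) renaming (suc to fsuc)
open import Data.Fin.Properties using (punchIn-injective)
open import Data.List using (_∷_; map; tabulate; allFin)
open import Data.List.Properties using (map-tabulate; map-injective)
open import Data.Vec.Functional using (head; tail)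
open import Data.Product using (_,_)
open import Function using (_∘_)
open import Relation.Binary.PropositionalEquality
open import Algebra.Properties.Semiring.Sum +-*-semiring
  using (sum; sum-syntax; sum-cong-≗; sum-remove; ∑-distrib-+; ∑-comm; *-distribʳ-sum)

open +-*-Solver using (solve; _:+_; _:*_; _:=_; con)

∑-const : ∀ n c → ∑[ i < n ] c ≡ n * c
∑-const zero    c = refl
∑-const (suc n) c = cong (c +_) (∑-const n c)

∑-mono-≤ : ∀ {n} {f g : Fin n → ℕ} → (∀ i → f i ≤ g i) → ∑[ i < n ] f i ≤ ∑[ i < n ] g i
∑-mono-≤ {zero}  f≤g = z≤n
∑-mono-≤ {suc n} f≤g = +-mono-≤ (f≤g _) (∑-mono-≤ (f≤g ∘ fsuc))

sum-tabulate : ∀ {n} (f : Fin n → ℕ) → List.sum (tabulate f) ≡ ∑[ i < n ] f i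
sum-tabulate {zero}  f = refl
sum-tabulate {suc n} f = cong (head f +_) (sum-tabulate (tail f))

sum-map-allFin : ∀ {n} (f : Fin n → ℕ) → List.sum (map f (allFin n)) ≡ ∑[ i < n ] f i
sum-map-allFin f = trans (cong List.sum (map-tabulate (λ i → i) f)) (sum-tabulate f)

module _ {n : ℕ} (G : Digraph n) where

  outdeg indeg : Fin n → ℕ
  outdeg x = ∑[ y < n ] bit (arc G x y)
  indeg  y = ∑[ x < n ] bit (arc G x y)

  size≡∑-outdeg : size G ≡ ∑[ x < n ] outdeg x
  size≡∑-outdeg =
    trans (sum-map-allFin (λ x → List.sum (map (λ y → bit (arc G x y)) (allFin n))))
          (sum-cong-≗ (λ x → sum-map-allFin (λ y → bit (arc G x y))))

  size≡∑-indeg : size G ≡ ∑[ y < n ] indeg y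
  size≡∑-indeg = trans size≡∑-outdeg (∑-comm (λ x y → bit (arc G x y)))

removeVertex : ∀ {n} → Digraph (suc n) → Fin (suc n) → Digraph n
removeVertex G v = record
  { arc      = λ x y → arc G (punchIn v x) (punchIn v y)
  ; loopless = λ x → loopless G (punchIn v x)
  }

module _ {n : ℕ} (G : Digraph (suc n)) (v : Fin (suc n)) where

  liftWalk : ∀ {ℓ x y} → Walk (removeVertex G v) ℓ x y → Walk G ℓ (punchIn v x) (punchIn v y)
  liftWalk (here x)   = here (punchIn v x)
  liftWalk (step a w) = step a (liftWalk w)

  vertices-liftWalk : ∀ {ℓ x y} (w : Walk (removeVertex G v) ℓ x y) →
    vertices (liftWalk w) ≡ map (punchIn v) (vertices w)
  vertices-liftWalk (here x)   = refl
  vertices-liftWalk (step a w) = cong (_ ∷_) (vertices-liftWalk w)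

  removeVertex-geodetic : ∀ {k} → Geodetic k G → Geodetic k (removeVertex G v)
  removeVertex-geodetic geo x y ℓ₁≤k ℓ₂≤k w₁ w₂ =
    map-injective (punchIn-injective v _ _) (begin
      map (punchIn v) (vertices w₁)  ≡⟨ vertices-liftWalk w₁ ⟨
      vertices (liftWalk w₁)         ≡⟨ geo _ _ ℓ₁≤k ℓ₂≤k (liftWalk w₁) (liftWalk w₂) ⟩
      vertices (liftWalk w₂)         ≡⟨ vertices-liftWalk w₂ ⟩
      map (punchIn v) (vertices w₂)  ∎)
    where open ≡-Reasoning

  indeg-removeVertex : indeg G v ≡ ∑[ x < n ] bit (arc G (punchIn v x) v)
  indeg-removeVertex = trans (sum-remove {i = v} (λ x → bit (arc G x v)))
                             (cong (λ b → bit b + ∑[ x < n ] bit (arc G (punchIn v x) v)) (loopless G v))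

  size-removeVertex : size G ≡ outdeg G v + (indeg G v + size (removeVertex G v))
  size-removeVertex = begin
    size G
      ≡⟨ size≡∑-outdeg G ⟩
    ∑[ x < suc n ] outdeg G x
      ≡⟨ sum-remove {i = v} (outdeg G) ⟩
    outdeg G v + ∑[ x < n ] outdeg G (punchIn v x)
      ≡⟨ cong (outdeg G v +_) (sum-cong-≗ (λ x → sum-remove {i = v} (λ y → bit (arc G (punchIn v x) y)))) ⟩
    outdeg G v + ∑[ x < n ] (bit (arc G (punchIn v x) v) + outdeg G' x)
      ≡⟨ cong (outdeg G v +_) (∑-distrib-+ (λ x → bit (arc G (punchIn v x) v)) (outdeg G')) ⟩
    outdeg G v + (∑[ x < n ] bit (arc G (punchIn v x) v) + ∑[ x < n ] outdeg G' x)
      ≡⟨ cong (outdeg G v +_) (cong₂ _+_ indeg-removeVertex (size≡∑-outdeg G')) ⟨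
    outdeg G v + (indeg G v + size G') ∎
    where
    open ≡-Reasoning
    G' = removeVertex G v

∑-size-removeVertex+2*size : ∀ {n} (G : Digraph (suc n)) →
  ∑[ v < suc n ] size (removeVertex G v) + 2 * size G ≡ suc n * size G
∑-size-removeVertex+2*size {n} G = begin
  R + 2 * s                                                      ≡⟨ solve 2 (λ r t → r :+ con 2 :* t := t :+ (t :+ r)) refl R s ⟩
  s + (s + R)                                                    ≡⟨ cong₂ (λ a b → a + (b + R)) (size≡∑-outdeg G) (size≡∑-indeg G) ⟩
  ∑[ v < suc n ] outdeg G v + (∑[ v < suc n ] indeg G v + R)     ≡⟨ cong (sum (outdeg G) +_) (∑-distrib-+ (indeg G) R′) ⟨
  ∑[ v < suc n ] outdeg G v + ∑[ v < suc n ] (indeg G v + R′ v)  ≡⟨ ∑-distrib-+ (outdeg G) (λ v → indeg G v + R′ v) ⟨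
  ∑[ v < suc n ] (outdeg G v + (indeg G v + R′ v))               ≡⟨ sum-cong-≗ (size-removeVertex G) ⟨
  ∑[ v < suc n ] s                                               ≡⟨ ∑-const (suc n) s ⟩
  suc n * s                                                      ∎
  where
  open ≡-Reasoning
  s = size G
  R′ = λ v → size (removeVertex G v)
  R = ∑[ v < suc n ] R′ v

-- For n = 0 both sides vanish because a digraph on one vertex has no arcs.
∑-size-removeVertex : ∀ {n} (G : Digraph (suc n)) →
  ∑[ v < suc n ] size (removeVertex G v) ≡ (n ∸ 1) * size G
∑-size-removeVertex {zero}  G = refl
∑-size-removeVertex {suc n} G = +-cancelʳ-≡ (2 * size G) _ _
  (trans (∑-size-removeVertex+2*size G)
         (trans (*-distribʳ-+ (size G) 2 n) (+-comm (2 * size G) (n * size G))))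

size-bound : ∀ {k m e} → 2 ≤ m → IsEx m k e → ∀ {n} → m ≤′ n →
  (G : Digraph n) → Geodetic k G → size G * (m * (m ∸ 1)) ≤ n * (n ∸ 1) * e
size-bound {m = m} {e} _ (_ , maximal) ≤′-refl G geo =
  ≤-trans (*-monoˡ-≤ (m * (m ∸ 1)) (maximal G geo)) (≤-reflexive (*-comm e _))
size-bound {m = m} {e} 2≤m ex {suc n} (≤′-step m≤′n) G geo = *-cancelˡ-≤ (n ∸ 1) (begin
  (n ∸ 1) * (s * c)                             ≡⟨ *-assoc (n ∸ 1) s c ⟨
  (n ∸ 1) * s * c                               ≡⟨ cong (_* c) (∑-size-removeVertex G) ⟨
  (∑[ v < suc n ] size (removeVertex G v)) * c  ≡⟨ *-distribʳ-sum c (λ v → size (removeVertex G v)) ⟩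
  ∑[ v < suc n ] (size (removeVertex G v) * c)  ≤⟨ ∑-mono-≤ bound-removeVertex ⟩
  ∑[ v < suc n ] (n * (n ∸ 1) * e)              ≡⟨ ∑-const (suc n) _ ⟩
  suc n * (n * (n ∸ 1) * e)                     ≡⟨ solve 4 (λ a b c d → a :* (b :* c :* d) := c :* (a :* b :* d)) refl (suc n) n (n ∸ 1) e ⟩
  (n ∸ 1) * (suc n * n * e)                     ∎)
  where
  open ≤-Reasoning
  s = size G
  c = m * (m ∸ 1)
  bound-removeVertex : ∀ v → size (removeVertex G v) * c ≤ n * (n ∸ 1) * e
  bound-removeVertex v = size-bound 2≤m ex m≤′n (removeVertex G v) (removeVertex-geodetic G v geo)
  instance
    n∸1≢0 : NonZero (n ∸ 1)
    n∸1≢0 = >-nonZero (m<n⇒0<n∸m (≤-trans 2≤m (≤′⇒≤ m≤′n)))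

lemma7 : ∀ (n k m exn exm : ℕ) → 2 ≤ k → k ≤ m → m < n →
    IsEx n k exn → IsEx m k exm →
    exn * (m * (m ∸ 1)) ≤ (n * (n ∸ 1)) * exm
lemma7 n k m exn exm 2≤k k≤m m<n ((G , geo , size≡exn) , _) exM =
  subst (λ s → s * (m * (m ∸ 1)) ≤ n * (n ∸ 1) * exm) size≡exn
    (size-bound (≤-trans 2≤k k≤m) exM (≤⇒≤′ (<⇒≤ m<n)) G geo)
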